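{- Let $V$ be a B-saturated variety of Heyting algebras, let $A$ be a formula, let $\pi$ be a finite set of variables with $\pi(A)\subsetneq\pi$, and let $p\in\pi\setminus\pi(A)$. The following are equivalent: (a) $V\models A$; (b) $V\models W(A,\pi,p)$; (c) $V\models A^\pi$.
   Context: Formulas are built from a countable set of propositional variables using $\land,\lor,\to$ and the constant $\bot$. $\pi(A)$ is the set of variables occurring in $A$. For a finite nonempty set $\pi$ of variables, $\pi^\land$ is the conjunction of the variables in $\pi$. $A^\pi$ is obtained from $A$ by replacing each occurrence of $\bot$ by $\pi^\land$, and $A^p$ is obtained by replacing each occurrence of $\bot$ by the variable $p$. The Wajsberg reduction is $W(A,\pi,p)=(p\to\pi^\land)\to A^p$. A Brouwerian algebra is an algebra $(A,\land,\lor,\to,1)$ in which $(A,\land,\lor)$ is a distributive lattice with top $1$ and $\to$ is relative pseudo-complementation. A Heyting algebra additionally has a constant $0$ which is the least element. $V\models A$ means that $A$ evaluates to $1$ under every valuation in every algebra of $V$. For a Heyting algebra $A$, $A^+$ is its $\{\land,\lor,\to,1\}$-reduct. A Heyting algebra $A$ is B-embedded in a Heyting algebra $C$ if $A^+$ embeds into $C^+$ as a Brouwerian algebra. A variety $V$ of Heyting algebras is B-saturated if every Heyting algebra B-embedded in some member of $V$ belongs to $V$. -}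

module Defs where

open import Level using (Level; _⊔_; 0ℓ) renaming (suc to lsuc)
open import Data.Nat using (ℕ)
open import Data.Product using (Σ; _×_; _,_)
open import Data.List using (List; []; _∷_)
open import Data.List.NonEmpty using (List⁺; _∷_)
open import Relation.Binary.Lattice.Bundles using (HeytingAlgebra)
open import Relation.Unary using (Pred)

infixr 5 _⇒_
infixr 6 _∨̇_
infixr 7 _∧̇_

data Fm : Set where
  var  : ℕ → Fm
  _∧̇_  : Fm → Fm → Fm
  _∨̇_  : Fm → Fm → Fm
  _⇒_  : Fm → Fm → Fm
  ⊥̇    : Fm

data _∈π_ (x : ℕ) : Fm → Set where
  here : x ∈π var x
  ∧ˡ   : ∀ {A B} → x ∈π A → x ∈π (A ∧̇ B)
  ∧ʳ   : ∀ {A B} → x ∈π B → x ∈π (A ∧̇ B)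
  ∨ˡ   : ∀ {A B} → x ∈π A → x ∈π (A ∨̇ B)
  ∨ʳ   : ∀ {A B} → x ∈π B → x ∈π (A ∨̇ B)
  ⇒ˡ   : ∀ {A B} → x ∈π A → x ∈π (A ⇒ B)
  ⇒ʳ   : ∀ {A B} → x ∈π B → x ∈π (A ⇒ B)

replace⊥ : Fm → Fm → Fm
replace⊥ (var x)  C = var x
replace⊥ (A ∧̇ B)  C = replace⊥ A C ∧̇ replace⊥ B C
replace⊥ (A ∨̇ B)  C = replace⊥ A C ∨̇ replace⊥ B C
replace⊥ (A ⇒ B)  C = replace⊥ A C ⇒ replace⊥ B C
replace⊥ ⊥̇       C = C

-- π^∧ : conjunction of the variables of a finite nonempty set π
-- (finite sets represented as nonempty lists)
conjList : ℕ → List ℕ → Fm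
conjList x []       = var x
conjList x (y ∷ ys) = var x ∧̇ conjList y ys

conj : List⁺ ℕ → Fm
conj (x ∷ xs) = conjList x xs

_^π_ : Fm → List⁺ ℕ → Fm
A ^π π = replace⊥ A (conj π)

_^v_ : Fm → ℕ → Fm
A ^v p = replace⊥ A (var p)

W : Fm → List⁺ ℕ → ℕ → Fm
W A π p = (var p ⇒ conj π) ⇒ (A ^v p)

module _ {c ℓ₁ ℓ₂ : Level} (H : HeytingAlgebra c ℓ₁ ℓ₂) where
  open HeytingAlgebra H

  ⟦_⟧ : Fm → (ℕ → Carrier) → Carrier
  ⟦ var x ⟧ v = v x
  ⟦ A ∧̇ B ⟧ v = ⟦ A ⟧ v ∧ ⟦ B ⟧ v
  ⟦ A ∨̇ B ⟧ v = ⟦ A ⟧ v ∨ ⟦ B ⟧ v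
  ⟦ A ⇒ B ⟧ v = ⟦ A ⟧ v ⇨ ⟦ B ⟧ v
  ⟦ ⊥̇ ⟧ v     = ⊥

  _⊨_ : Fm → Set (c ⊔ ℓ₁)
  _⊨_ A = ∀ (v : ℕ → Carrier) → ⟦ A ⟧ v ≈ ⊤

_⊨V_ : {c ℓ₁ ℓ₂ ℓ : Level} → Pred (HeytingAlgebra c ℓ₁ ℓ₂) ℓ → Fm → Set (lsuc (c ⊔ ℓ₁ ⊔ ℓ₂) ⊔ ℓ)
V ⊨V A = ∀ H → V H → _⊨_ H A

data Term : Set where
  tvar : ℕ → Term
  _t∧_ _t∨_ _t⇒_ : Term → Term → Term
  t0 t1 : Term

module _ {c ℓ₁ ℓ₂ : Level} (H : HeytingAlgebra c ℓ₁ ℓ₂) where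
  open HeytingAlgebra H

  evalT : Term → (ℕ → Carrier) → Carrier
  evalT (tvar x)  v = v x
  evalT (s t∧ t)  v = evalT s v ∧ evalT t v
  evalT (s t∨ t)  v = evalT s v ∨ evalT t v
  evalT (s t⇒ t)  v = evalT s v ⇨ evalT t v
  evalT t0        v = ⊥
  evalT t1        v = ⊤

  Satisfies : Term × Term → Set (c ⊔ ℓ₁)
  Satisfies (s , t) = ∀ (v : ℕ → Carrier) → evalT s v ≈ evalT t v

IsVariety : {c ℓ₁ ℓ₂ ℓ : Level} → Pred (HeytingAlgebra c ℓ₁ ℓ₂) ℓ → Set (lsuc (c ⊔ ℓ₁ ⊔ ℓ₂) ⊔ ℓ)
IsVariety {c} {ℓ₁} {ℓ₂} V =
  Σ (Pred (Term × Term) 0ℓ) λ E →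
    ∀ (H : HeytingAlgebra c ℓ₁ ℓ₂) →
      (V H → ∀ e → E e → Satisfies H e) × ((∀ e → E e → Satisfies H e) → V H)

-- B-embeddings: embeddings of the Brouwerian reducts {∧,∨,→,1}

record BEmbedding {c ℓ₁ ℓ₂ c' ℓ₁' ℓ₂' : Level}
                  (A : HeytingAlgebra c ℓ₁ ℓ₂) (C : HeytingAlgebra c' ℓ₁' ℓ₂')
                  : Set (c ⊔ c' ⊔ ℓ₁ ⊔ ℓ₁') where
  private
    module A = HeytingAlgebra A
    module C = HeytingAlgebra C
  field
    f        : A.Carrier → C.Carrier
    cong     : ∀ {x y} → x A.≈ y → f x C.≈ f y
    injective : ∀ {x y} → f x C.≈ f y → x A.≈ y
    pres-∧   : ∀ x y → f (x A.∧ y) C.≈ (f x C.∧ f y)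
    pres-∨   : ∀ x y → f (x A.∨ y) C.≈ (f x C.∨ f y)
    pres-⇨   : ∀ x y → f (x A.⇨ y) C.≈ (f x C.⇨ f y)
    pres-⊤   : f A.⊤ C.≈ C.⊤

BSaturated : {c ℓ₁ ℓ₂ ℓ : Level} → Pred (HeytingAlgebra c ℓ₁ ℓ₂) ℓ → Set (lsuc (c ⊔ ℓ₁ ⊔ ℓ₂) ⊔ ℓ)
BSaturated V = ∀ A C → V C → BEmbedding A C → V A

module Submission where

-- (b) ⇒ (c) and (c) ⇒ (a) are substitution arguments valid for any
-- class V: instantiating p by π^∧ makes the antecedent of W(A,π,p) true
-- and turns A^p into A^π, and instantiating p by 0 makes π^∧ false and
-- turns A^π into A (p does not occur in A).
--
-- Given H ∈ V and a valuation v, put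
-- k = v(p) and d = k → π^∧(v).  The slice of H at (k, d) is the Heyting
-- algebra on the carrier of H in which x and y are identified when
-- (d ∧ x) ∨ k = (d ∧ y) ∨ k; in it k becomes the bottom.  The slice at
-- (0, d) is the quotient of H by the filter generated by d, hence lies in
-- the variety V, and x ↦ x ∨ k B-embeds the slice at (k, d) into it, so
-- by B-saturation the slice at (k, d) lies in V as well.  Every variable
-- of A is above d ∧ k, and for such valuations the value of A in the
-- slice is the value of A in H with ⊥ read as k; validity of A in the
-- slice therefore gives d ≤ A^p(v), i.e. W(A,π,p) holds at v.

open import Defs
open import Level using (Level)
open import Data.Nat using (ℕ; _≟_)
open import Data.List using ([]; _∷_)
open import Data.List.NonEmpty using (List⁺; toList; _∷_)
open import Data.List.Membership.Propositional using (_∈_)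
open import Data.List.Relation.Unary.Any using (here; there)
open import Data.Product using (_×_; _,_; proj₁; proj₂)
open import Data.Empty using (⊥-elim)
open import Function.Base using (_∘_)
open import Function.Bundles using (_⇔_; mk⇔)
open import Relation.Nullary using (¬_; yes; no)
open import Relation.Unary using (Pred)
open import Relation.Binary.Lattice.Bundles using (HeytingAlgebra)
open import Relation.Binary.PropositionalEquality using (_≡_; _≢_; refl; sym; cong₂)
import Relation.Binary.Lattice.Properties.HeytingAlgebra as HeytingProperties
import Relation.Binary.Lattice.Properties.DistributiveLattice as DistributiveProperties
import Relation.Binary.Lattice.Properties.BoundedJoinSemilattice as BoundedJoinProperties
import Relation.Binary.Lattice.Properties.BoundedLattice as BoundedLatticeProperties
import Relation.Binary.Lattice.Properties.MeetSemilattice as MeetProperties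
import Relation.Binary.Lattice.Properties.JoinSemilattice as JoinProperties
import Relation.Binary.Reasoning.Setoid as SetoidReasoning

_[_↦_] : ∀ {a} {C : Set a} → (ℕ → C) → ℕ → C → ℕ → C
(v [ p ↦ b ]) x with x ≟ p
... | yes _ = b
... | no  _ = v x

update-same : ∀ {a} {C : Set a} (v : ℕ → C) p b → (v [ p ↦ b ]) p ≡ b
update-same v p b with p ≟ p
... | yes _  = refl
... | no p≢p = ⊥-elim (p≢p refl)

update-other : ∀ {a} {C : Set a} (v : ℕ → C) p b {x} → x ≢ p → (v [ p ↦ b ]) x ≡ v x
update-other v p b {x} x≢p with x ≟ p
... | yes x≡p = ⊥-elim (x≢p x≡p)
... | no  _   = refl

occurs-≢ : ∀ {p x A} → ¬ (p ∈π A) → x ∈π A → x ≢ p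
occurs-≢ p∉A x∈A refl = p∉A x∈A

module HeytingFacts {c ℓ₁ ℓ₂ : Level} (H : HeytingAlgebra c ℓ₁ ℓ₂) where
  open HeytingAlgebra H renaming (refl to ≤-refl)
  open HeytingProperties H
    using (⇨-cong; ⇨-eval; ⇨-applyʳ; ⇨-relax; ⇨ʳ-covariant; y≤x⇨y; ∧-distribˡ-∨-≤; distributiveLattice)
  open DistributiveProperties distributiveLattice using (∨-distribʳ-∧)
  open BoundedJoinProperties boundedJoinSemilattice using (identityʳ)
  open BoundedLatticeProperties boundedLattice using (∨-zeroˡ)
  open MeetProperties meetSemilattice using (∧-cong; ∧-assoc; ∧-monotonic)
  open JoinProperties joinSemilattice using (∨-cong; ∨-monotonic)

  infixr 4 _⟫_
  _⟫_ : ∀ {x y z} → x ≤ y → y ≤ z → x ≤ z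
  _⟫_ = trans

  ∧-lowerˡ : ∀ {x y} → x ∧ y ≤ x
  ∧-lowerˡ = x∧y≤x _ _

  ∧-lowerʳ : ∀ {x y} → x ∧ y ≤ y
  ∧-lowerʳ = x∧y≤y _ _

  ∨-upperˡ : ∀ {x y} → x ≤ x ∨ y
  ∨-upperˡ = x≤x∨y _ _

  ∨-upperʳ : ∀ {x y} → y ≤ x ∨ y
  ∨-upperʳ = y≤x∨y _ _

  modusPonens : ∀ {w x y} → w ≤ x → w ≤ x ⇨ y → w ≤ y
  modusPonens w≤x w≤x⇨y = ∧-greatest w≤x⇨y w≤x ⟫ ⇨-eval

  distrib : ∀ {w e x y} → w ≤ e → w ≤ x ∨ y → w ≤ (e ∧ x) ∨ (e ∧ y)
  distrib {e = e} {x} {y} w≤e w≤x∨y = ∧-greatest w≤e w≤x∨y ⟫ ∧-distribˡ-∨-≤ e x y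

  ⟦_⟧ᴴ : Fm → (ℕ → Carrier) → Carrier
  ⟦ A ⟧ᴴ v = ⟦_⟧ H A v

  ⟦_∣_⟧ : Fm → Carrier → (ℕ → Carrier) → Carrier
  ⟦ var x ∣ b ⟧ v = v x
  ⟦ A ∧̇ B ∣ b ⟧ v = ⟦ A ∣ b ⟧ v ∧ ⟦ B ∣ b ⟧ v
  ⟦ A ∨̇ B ∣ b ⟧ v = ⟦ A ∣ b ⟧ v ∨ ⟦ B ∣ b ⟧ v
  ⟦ A ⇒ B ∣ b ⟧ v = ⟦ A ∣ b ⟧ v ⇨ ⟦ B ∣ b ⟧ v
  ⟦ ⊥̇ ∣ b ⟧ v     = b

  eval-replace⊥ : ∀ A C v → ⟦ replace⊥ A C ⟧ᴴ v ≡ ⟦ A ∣ ⟦ C ⟧ᴴ v ⟧ v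
  eval-replace⊥ (var x) C v = refl
  eval-replace⊥ (A ∧̇ B) C v = cong₂ _∧_ (eval-replace⊥ A C v) (eval-replace⊥ B C v)
  eval-replace⊥ (A ∨̇ B) C v = cong₂ _∨_ (eval-replace⊥ A C v) (eval-replace⊥ B C v)
  eval-replace⊥ (A ⇒ B) C v = cong₂ _⇨_ (eval-replace⊥ A C v) (eval-replace⊥ B C v)
  eval-replace⊥ ⊥̇ C v       = refl

  eval-bottom : ∀ A v → ⟦ A ⟧ᴴ v ≡ ⟦ A ∣ ⊥ ⟧ v
  eval-bottom (var x) v = refl
  eval-bottom (A ∧̇ B) v = cong₂ _∧_ (eval-bottom A v) (eval-bottom B v)
  eval-bottom (A ∨̇ B) v = cong₂ _∨_ (eval-bottom A v) (eval-bottom B v)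
  eval-bottom (A ⇒ B) v = cong₂ _⇨_ (eval-bottom A v) (eval-bottom B v)
  eval-bottom ⊥̇ v       = refl

  eval-local : ∀ A {b b′ v w} → b ≈ b′ → (∀ x → x ∈π A → v x ≈ w x) → ⟦ A ∣ b ⟧ v ≈ ⟦ A ∣ b′ ⟧ w
  eval-local (var x) b≈b′ v≈w = v≈w x here
  eval-local (A ∧̇ B) b≈b′ v≈w =
    ∧-cong (eval-local A b≈b′ (λ x → v≈w x ∘ ∧ˡ)) (eval-local B b≈b′ (λ x → v≈w x ∘ ∧ʳ))
  eval-local (A ∨̇ B) b≈b′ v≈w =
    ∨-cong (eval-local A b≈b′ (λ x → v≈w x ∘ ∨ˡ)) (eval-local B b≈b′ (λ x → v≈w x ∘ ∨ʳ))
  eval-local (A ⇒ B) b≈b′ v≈w =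
    ⇨-cong (eval-local A b≈b′ (λ x → v≈w x ∘ ⇒ˡ)) (eval-local B b≈b′ (λ x → v≈w x ∘ ⇒ʳ))
  eval-local ⊥̇ b≈b′ v≈w = b≈b′

  eval-update : ∀ A {p a b b′ v} → ¬ (p ∈π A) → b ≈ b′ → ⟦ A ∣ b ⟧ (v [ p ↦ a ]) ≈ ⟦ A ∣ b′ ⟧ v
  eval-update A {p} {a} {v = v} p∉A b≈b′ =
    eval-local A b≈b′ (λ x x∈A → Eq.reflexive (update-other v p a (occurs-≢ p∉A x∈A)))

  eval-lowerBound : ∀ A {m b v} → m ≤ b → (∀ x → x ∈π A → m ≤ v x) → m ≤ ⟦ A ∣ b ⟧ v
  eval-lowerBound (var x) m≤b m≤v = m≤v x here
  eval-lowerBound (A ∧̇ B) m≤b m≤v =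
    ∧-greatest (eval-lowerBound A m≤b (λ x → m≤v x ∘ ∧ˡ)) (eval-lowerBound B m≤b (λ x → m≤v x ∘ ∧ʳ))
  eval-lowerBound (A ∨̇ B) m≤b m≤v = eval-lowerBound A m≤b (λ x → m≤v x ∘ ∨ˡ) ⟫ ∨-upperˡ
  eval-lowerBound (A ⇒ B) m≤b m≤v = eval-lowerBound B m≤b (λ x → m≤v x ∘ ⇒ʳ) ⟫ y≤x⇨y
  eval-lowerBound ⊥̇ m≤b m≤v = m≤b

  conj-lower : ∀ π {v y} → y ∈ toList π → ⟦ conj π ⟧ᴴ v ≤ v y
  conj-lower (x ∷ xs) = lower x xs
    where
      lower : ∀ x xs {v y} → y ∈ x ∷ xs → ⟦ conjList x xs ⟧ᴴ v ≤ v y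
      lower x []       (here refl)  = ≤-refl
      lower x (z ∷ zs) (here refl)  = ∧-lowerˡ
      lower x (z ∷ zs) (there y∈zs) = ∧-lowerʳ ⟫ lower z zs y∈zs

  conj-greatest : ∀ π {v m} → (∀ y → y ∈ toList π → m ≤ v y) → m ≤ ⟦ conj π ⟧ᴴ v
  conj-greatest (x ∷ xs) = greatest x xs
    where
      greatest : ∀ x xs {v m} → (∀ y → y ∈ x ∷ xs → m ≤ v y) → m ≤ ⟦ conjList x xs ⟧ᴴ v
      greatest x []       m≤v = m≤v x (here refl)
      greatest x (z ∷ zs) m≤v = ∧-greatest (m≤v x (here refl)) (greatest z zs (λ y → m≤v y ∘ there))

  update-lower : ∀ {v p b m} y → m ≤ b → m ≤ v y → m ≤ (v [ p ↦ b ]) y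
  update-lower {p = p} y m≤b m≤vy with y ≟ p
  ... | yes _ = m≤b
  ... | no  _ = m≤vy

  module Slice (k d : Carrier) where
    project : Carrier → Carrier
    project x = (d ∧ x) ∨ k

    _≈ₛ_ : Carrier → Carrier → Set ℓ₁
    x ≈ₛ y = project x ≈ project y

    _≤ₛ_ : Carrier → Carrier → Set ℓ₂
    x ≤ₛ y = d ∧ x ≤ y ∨ k

    _⇨ₛ_ : Carrier → Carrier → Carrier
    x ⇨ₛ y = x ⇨ (y ∨ k)

    ≤⇒≤ₛ : ∀ {x y} → x ≤ y → x ≤ₛ y
    ≤⇒≤ₛ x≤y = ∧-lowerʳ ⟫ x≤y ⟫ ∨-upperˡ

    ≈⇒≈ₛ : ∀ {x y} → x ≈ y → x ≈ₛ y
    ≈⇒≈ₛ x≈y = ∨-cong (∧-cong Eq.refl x≈y) Eq.refl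

    cancel : ∀ {w y z} → w ≤ d → w ≤ y ∨ k → y ≤ₛ z → w ≤ z ∨ k
    cancel w≤d w≤y∨k y≤ₛz = distrib w≤d w≤y∨k ⟫ ∨-least y≤ₛz (∧-lowerʳ ⟫ ∨-upperʳ)

    absorb : ∀ {w y} → w ≤ d → w ≤ y ∨ k → d ∧ k ≤ y → w ≤ y
    absorb w≤d w≤y∨k dk≤y = distrib w≤d w≤y∨k ⟫ ∨-least ∧-lowerʳ dk≤y

    ≤ₛ-trans : ∀ {x y z} → x ≤ₛ y → y ≤ₛ z → x ≤ₛ z
    ≤ₛ-trans = cancel ∧-lowerˡ

    ≈ₛ⇒≤ₛ : ∀ {x y} → x ≈ₛ y → x ≤ₛ y
    ≈ₛ⇒≤ₛ x≈ₛy = ∨-upperˡ ⟫ reflexive x≈ₛy ⟫ ∨-least (∧-lowerʳ ⟫ ∨-upperˡ) ∨-upperʳ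

    ≤ₛ-antisym : ∀ {x y} → x ≤ₛ y → y ≤ₛ x → x ≈ₛ y
    ≤ₛ-antisym x≤ₛy y≤ₛx = antisym (project-mono x≤ₛy) (project-mono y≤ₛx)
      where
        project-mono : ∀ {x y} → x ≤ₛ y → project x ≤ project y
        project-mono x≤ₛy = ∨-least (cancel ∧-lowerˡ x≤ₛy ∨-upperˡ) ∨-upperʳ

    ∨ₛ-least : ∀ {x y z} → x ≤ₛ z → y ≤ₛ z → (x ∨ y) ≤ₛ z
    ∨ₛ-least {x} {y} x≤ₛz y≤ₛz = ∧-distribˡ-∨-≤ d x y ⟫ ∨-least x≤ₛz y≤ₛz

    ∧ₛ-greatest : ∀ {x y z} → z ≤ₛ x → z ≤ₛ y → z ≤ₛ (x ∧ y)
    ∧ₛ-greatest {x} {y} z≤ₛx z≤ₛy = ∧-greatest z≤ₛx z≤ₛy ⟫ reflexive (Eq.sym (∨-distribʳ-∧ k x y))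

    ⇨ₛ-curry : ∀ {w x y} → (w ∧ x) ≤ₛ y → w ≤ₛ (x ⇨ₛ y)
    ⇨ₛ-curry {w} {x} wx≤ₛy = transpose-⇨ (reflexive (∧-assoc d w x) ⟫ wx≤ₛy) ⟫ ∨-upperˡ

    ⇨ₛ-uncurry : ∀ {w x y} → w ≤ₛ (x ⇨ₛ y) → (w ∧ x) ≤ₛ y
    ⇨ₛ-uncurry {w} {x} w≤ₛx⇨y =
      distrib (∧-lowerʳ ⟫ ∧-lowerʳ) (reflexive (Eq.sym (∧-assoc d w x)) ⟫ ∧-lowerˡ ⟫ w≤ₛx⇨y)
        ⟫ ∨-least (⇨-applyʳ ≤-refl) (∧-lowerʳ ⟫ ∨-upperʳ)

    sliceAlgebra : HeytingAlgebra c ℓ₁ ℓ₂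
    sliceAlgebra = record
      { Carrier = Carrier
      ; _≈_ = _≈ₛ_
      ; _≤_ = _≤ₛ_
      ; _∨_ = _∨_
      ; _∧_ = _∧_
      ; _⇨_ = _⇨ₛ_
      ; ⊤ = ⊤
      ; ⊥ = ⊥
      ; isHeytingAlgebra = record
        { isBoundedLattice = record
          { isLattice = record
            { isPartialOrder = record
              { isPreorder = record
                { isEquivalence = record { refl = Eq.refl ; sym = Eq.sym ; trans = Eq.trans }
                ; reflexive = ≈ₛ⇒≤ₛ
                ; trans = ≤ₛ-trans
                }
              ; antisym = ≤ₛ-antisym
              }
            ; supremum = λ x y → ≤⇒≤ₛ ∨-upperˡ , ≤⇒≤ₛ ∨-upperʳ , λ _ → ∨ₛ-least
            ; infimum = λ x y → ≤⇒≤ₛ ∧-lowerˡ , ≤⇒≤ₛ ∧-lowerʳ , λ _ → ∧ₛ-greatest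
            }
          ; maximum = λ x → ≤⇒≤ₛ (maximum x)
          ; minimum = λ x → ≤⇒≤ₛ (minimum x)
          }
        ; exponential = λ _ _ _ → ⇨ₛ-curry , ⇨ₛ-uncurry
        }
      }

    open HeytingProperties sliceAlgebra using () renaming (⇨-cong to ⇨ₛ-cong)
    open MeetProperties (HeytingAlgebra.meetSemilattice sliceAlgebra) using () renaming (∧-cong to ∧ₛ-cong)
    open JoinProperties (HeytingAlgebra.joinSemilattice sliceAlgebra) using () renaming (∨-cong to ∨ₛ-cong)

    ⟦_⟧ˢ : Fm → (ℕ → Carrier) → Carrier
    ⟦ A ⟧ˢ v = ⟦_⟧ sliceAlgebra A v

    ⊥≈ₛk : ⊥ ≈ₛ k
    ⊥≈ₛk = ≤ₛ-antisym (≤⇒≤ₛ (minimum k)) (∧-lowerʳ ⟫ ∨-upperʳ)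

    ⇨ₛ-agrees : ∀ {x y} → d ∧ k ≤ y → (x ⇨ₛ y) ≈ₛ (x ⇨ y)
    ⇨ₛ-agrees dk≤y = ≤ₛ-antisym
      (transpose-⇨ (absorb (∧-lowerˡ ⟫ ∧-lowerˡ) (∧-greatest (∧-lowerˡ ⟫ ∧-lowerʳ) ∧-lowerʳ ⟫ ⇨-eval) dk≤y)
        ⟫ ∨-upperˡ)
      (≤⇒≤ₛ (⇨ʳ-covariant ∨-upperˡ))

    eval-slice : ∀ A {v} → (∀ x → x ∈π A → d ∧ k ≤ v x) → ⟦ A ⟧ˢ v ≈ₛ ⟦ A ∣ k ⟧ v
    eval-slice (var x) above = Eq.refl
    eval-slice (A ∧̇ B) above =
      ∧ₛ-cong (eval-slice A (λ x → above x ∘ ∧ˡ)) (eval-slice B (λ x → above x ∘ ∧ʳ))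
    eval-slice (A ∨̇ B) above =
      ∨ₛ-cong (eval-slice A (λ x → above x ∘ ∨ˡ)) (eval-slice B (λ x → above x ∘ ∨ʳ))
    eval-slice (A ⇒ B) {v} above =
      Eq.trans (⇨ₛ-cong (eval-slice A (λ x → above x ∘ ⇒ˡ)) (eval-slice B aboveB))
               (⇨ₛ-agrees (eval-lowerBound B ∧-lowerʳ aboveB))
      where
        aboveB : ∀ x → x ∈π B → d ∧ k ≤ v x
        aboveB x = above x ∘ ⇒ʳ
    eval-slice ⊥̇ above = ⊥≈ₛk

    slice-valid : ∀ A {v} → sliceAlgebra ⊨ A → (∀ x → x ∈π A → d ∧ k ≤ v x) → d ≤ ⟦ A ∣ k ⟧ v
    slice-valid A {v} valid above = absorb ≤-refl d≤A∨k (eval-lowerBound A ∧-lowerʳ above)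
      where
        ⊤≤ₛA : ⊤ ≤ₛ ⟦ A ∣ k ⟧ v
        ⊤≤ₛA = ≈ₛ⇒≤ₛ (Eq.trans (Eq.sym (valid v)) (eval-slice A above))

        d≤A∨k : d ≤ ⟦ A ∣ k ⟧ v ∨ k
        d≤A∨k = ∧-greatest ≤-refl (maximum d) ⟫ ⊤≤ₛA

  -- The slice at (⊥, d) is the quotient of H by the filter generated by d,
  -- so it satisfies every identity that H satisfies.
  quotient-satisfies : ∀ d e → Satisfies H e → Satisfies (Slice.sliceAlgebra ⊥ d) e
  quotient-satisfies d (s , t) s≈t u =
    Q.≈⇒≈ₛ (Eq.trans (evalT-quotient s) (Eq.trans (s≈t u) (Eq.sym (evalT-quotient t))))
    where
      module Q = Slice ⊥ d

      evalT-quotient : ∀ t → evalT Q.sliceAlgebra t u ≈ evalT H t u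
      evalT-quotient (tvar x) = Eq.refl
      evalT-quotient (s t∧ t) = ∧-cong (evalT-quotient s) (evalT-quotient t)
      evalT-quotient (s t∨ t) = ∨-cong (evalT-quotient s) (evalT-quotient t)
      evalT-quotient (s t⇒ t) = ⇨-cong (evalT-quotient s) (Eq.trans (∨-cong (evalT-quotient t) Eq.refl) (identityʳ _))
      evalT-quotient t0       = Eq.refl
      evalT-quotient t1       = Eq.refl

  raise : ∀ k d → BEmbedding (Slice.sliceAlgebra k d) (Slice.sliceAlgebra ⊥ d)
  raise k d = record
    { f         = _∨ k
    ; cong      = λ x≈y → Q.≤ₛ-antisym (up (S.≈ₛ⇒≤ₛ x≈y)) (up (S.≈ₛ⇒≤ₛ (Eq.sym x≈y)))
    ; injective = λ x≈y → S.≤ₛ-antisym (down (Q.≈ₛ⇒≤ₛ x≈y)) (down (Q.≈ₛ⇒≤ₛ (Eq.sym x≈y)))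
    ; pres-∧    = λ x y → Q.≈⇒≈ₛ (∨-distribʳ-∧ k x y)
    ; pres-∨    = λ x y → Q.≈⇒≈ₛ ∨-over-∨
    ; pres-⇨    = λ x y → Q.≈⇒≈ₛ ⇨-raised
    ; pres-⊤    = Q.≈⇒≈ₛ (∨-zeroˡ k)
    }
    where
      module S = Slice k d
      module Q = Slice ⊥ d

      up : ∀ {x y} → x S.≤ₛ y → (x ∨ k) Q.≤ₛ (y ∨ k)
      up {x} x≤ₛy = ∧-distribˡ-∨-≤ d x k ⟫ ∨-least x≤ₛy (∧-lowerʳ ⟫ ∨-upperʳ) ⟫ ∨-upperˡ

      down : ∀ {x y} → (x ∨ k) Q.≤ₛ (y ∨ k) → x S.≤ₛ y
      down x≤y = ∧-monotonic ≤-refl ∨-upperˡ ⟫ x≤y ⟫ ∨-least ≤-refl (minimum _)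

      ∨-over-∨ : ∀ {x y} → (x ∨ y) ∨ k ≈ (x ∨ k) ∨ (y ∨ k)
      ∨-over-∨ = antisym
        (∨-least (∨-monotonic ∨-upperˡ ∨-upperˡ) (∨-upperʳ ⟫ ∨-upperʳ))
        (∨-least (∨-monotonic ∨-upperˡ ≤-refl) (∨-monotonic ∨-upperʳ ≤-refl))

      ⇨-raised : ∀ {x y} → (x ⇨ (y ∨ k)) ∨ k ≈ (x ∨ k) ⇨ ((y ∨ k) ∨ ⊥)
      ⇨-raised {x} = antisym
        (∨-least
          (transpose-⇨ (∧-distribˡ-∨-≤ _ x k ⟫ ∨-least ⇨-eval (∧-lowerʳ ⟫ ∨-upperʳ) ⟫ ∨-upperˡ))
          (transpose-⇨ (∧-lowerˡ ⟫ ∨-upperʳ ⟫ ∨-upperˡ)))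
        (⇨-relax ∨-upperˡ (∨-least ≤-refl (minimum _)) ⟫ ∨-upperˡ)

  slice∈V : ∀ {ℓ} (V : Pred (HeytingAlgebra c ℓ₁ ℓ₂) ℓ) → IsVariety V → BSaturated V
    → V H → ∀ k d → V (Slice.sliceAlgebra k d)
  slice∈V V (E , defines) saturated H∈V k d = saturated _ _ quotient∈V (raise k d)
    where
      quotient∈V : V (Slice.sliceAlgebra ⊥ d)
      quotient∈V = proj₂ (defines _) (λ e e∈E → quotient-satisfies d e (proj₁ (defines H) H∈V e e∈E))

valid⇒wajsberg : ∀ {c ℓ₁ ℓ₂ ℓ} (V : Pred (HeytingAlgebra c ℓ₁ ℓ₂) ℓ) → IsVariety V → BSaturated V
  → ∀ A π p → (∀ x → x ∈π A → x ∈ toList π) → V ⊨V A → V ⊨V W A π p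
valid⇒wajsberg V variety saturated A π p A⊆π valid H H∈V v =
  antisym (maximum _) (transpose-⇨ (∧-lowerʳ ⟫ d≤A ⟫ reflexive (Eq.reflexive (sym (eval-replace⊥ A (var p) v)))))
  where
    open HeytingAlgebra H using (Carrier; antisym; maximum; transpose-⇨; reflexive; module Eq; _∧_; _≤_; _⇨_)
    open HeytingFacts H
    open HeytingProperties H using (⇨-eval)

    k : Carrier
    k = v p

    d : Carrier
    d = k ⇨ ⟦ conj π ⟧ᴴ v

    -- every variable of A lies above π^∧(v), which lies above d ∧ k
    above : ∀ x → x ∈π A → d ∧ k ≤ v x
    above x x∈A = ⇨-eval ⟫ conj-lower π (A⊆π x x∈A)

    d≤A : d ≤ ⟦ A ∣ k ⟧ v
    d≤A = Slice.slice-valid k d A (valid _ (slice∈V V variety saturated H∈V k d)) above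

-- (b) ⇒ (c): instantiate p by π^∧, which makes the antecedent p → π^∧ true.
wajsberg⇒conjInstance : ∀ {c ℓ₁ ℓ₂ ℓ} (V : Pred (HeytingAlgebra c ℓ₁ ℓ₂) ℓ)
  → ∀ A π p → ¬ (p ∈π A) → V ⊨V W A π p → V ⊨V (A ^π π)
wajsberg⇒conjInstance V A π p p∉A valid H H∈V v = begin
  ⟦ A ^π π ⟧ᴴ v              ≡⟨ eval-replace⊥ A (conj π) v ⟩
  ⟦ A ∣ c₀ ⟧ v               ≈⟨ eval-update A p∉A (Eq.reflexive (update-same v p c₀)) ⟨
  ⟦ A ∣ v′ p ⟧ v′            ≡⟨ eval-replace⊥ A (var p) v′ ⟨
  ⟦ A ^v p ⟧ᴴ v′             ≈⟨ antisym (maximum _) (modusPonens p⇨π (reflexive (Eq.sym (valid H H∈V v′)))) ⟩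
  ⊤                          ∎
  where
    open HeytingAlgebra H using (Carrier; antisym; maximum; transpose-⇨; reflexive; module Eq; setoid; ⊤; _≤_; _⇨_)
    open HeytingFacts H
    open SetoidReasoning setoid

    c₀ : Carrier
    c₀ = ⟦ conj π ⟧ᴴ v

    v′ : ℕ → Carrier
    v′ = v [ p ↦ c₀ ]

    -- c₀ = v′(p) lies below every v′(y) with y ∈ π
    p⇨π : ⊤ ≤ v′ p ⇨ ⟦ conj π ⟧ᴴ v′
    p⇨π = transpose-⇨ (∧-lowerʳ ⟫ reflexive (Eq.reflexive (update-same v p c₀))
            ⟫ conj-greatest π (λ y y∈π → update-lower y (reflexive Eq.refl) (conj-lower π y∈π)))

-- (c) ⇒ (a): instantiate p by 0, which makes π^∧ false.
conjInstance⇒valid : ∀ {c ℓ₁ ℓ₂ ℓ} (V : Pred (HeytingAlgebra c ℓ₁ ℓ₂) ℓ)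
  → ∀ A π p → p ∈ toList π → ¬ (p ∈π A) → V ⊨V (A ^π π) → V ⊨V A
conjInstance⇒valid V A π p p∈π p∉A valid H H∈V v = begin
  ⟦ A ⟧ᴴ v                     ≡⟨ eval-bottom A v ⟩
  ⟦ A ∣ ⊥ ⟧ v                  ≈⟨ eval-update A p∉A π^∧≈⊥ ⟨
  ⟦ A ∣ ⟦ conj π ⟧ᴴ v′ ⟧ v′    ≡⟨ eval-replace⊥ A (conj π) v′ ⟨
  ⟦ A ^π π ⟧ᴴ v′               ≈⟨ valid H H∈V v′ ⟩
  ⊤                            ∎
  where
    open HeytingAlgebra H using (Carrier; antisym; minimum; reflexive; module Eq; setoid; ⊤; ⊥; _≈_)
    open HeytingFacts H
    open SetoidReasoning setoid

    v′ : ℕ → Carrier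
    v′ = v [ p ↦ ⊥ ]

    π^∧≈⊥ : ⟦ conj π ⟧ᴴ v′ ≈ ⊥
    π^∧≈⊥ = antisym (conj-lower π p∈π ⟫ reflexive (Eq.reflexive (update-same v p ⊥))) (minimum _)

mainTheorem12 : {c ℓ₁ ℓ₂ ℓ : Level} (V : Pred (HeytingAlgebra c ℓ₁ ℓ₂) ℓ)
    → IsVariety V → BSaturated V
    → (A : Fm) (π : List⁺ ℕ) (p : ℕ)
    → (∀ x → x ∈π A → x ∈ toList π)
    → p ∈ toList π → ¬ (p ∈π A)
    → ((V ⊨V A) ⇔ (V ⊨V W A π p)) × ((V ⊨V W A π p) ⇔ (V ⊨V (A ^π π)))
mainTheorem12 V variety saturated A π p A⊆π p∈π p∉A =
  mk⇔ a⇒b (c⇒a ∘ b⇒c) , mk⇔ b⇒c (a⇒b ∘ c⇒a)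
  where
    a⇒b : V ⊨V A → V ⊨V W A π p
    a⇒b = valid⇒wajsberg V variety saturated A π p A⊆π
    b⇒c : V ⊨V W A π p → V ⊨V (A ^π π)
    b⇒c = wajsberg⇒conjInstance V A π p p∉A
    c⇒a : V ⊨V (A ^π π) → V ⊨V A
    c⇒a = conjInstance⇒valid V A π p p∈π p∉A
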